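{- Let $G$ be a finite simple undirected graph that is not complete and has vertex connectivity at least $2$. If $G$ is 1-chord free, then $G$ is triangle free.
   Context: For $U\subseteq V(G)$, $G[U]$ denotes the induced subgraph on $U$. $G$ is 1-chord free if there is no $U\subseteq V(G)$ such that $G[U]$ is a cycle of length at least $4$ with exactly one chord (i.e. $|U|\ge 4$ and the edges of $G[U]$ are the edges of a cycle through all of $U$ plus exactly one additional edge). The vertex connectivity of $G$ is the minimum size of a vertex set whose removal disconnects $G$ or leaves a single vertex. -}

module Defs where

open import Data.Nat using (ℕ; suc; _+_; _≤_; _%_)
open import Data.Fin using (Fin; toℕ)
open import Data.Fin.Subset using (Subset; _∈_; _∉_; ∣_∣)
open import Data.Bool using (Bool; true; false)
open import Data.Product using (Σ; ∃; _×_; _,_)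
open import Data.Sum using (_⊎_)
open import Relation.Binary.PropositionalEquality using (_≡_; _≢_)
open import Relation.Nullary using (¬_)
open import Data.Empty using (⊥)
open import Function.Definitions using (Injective)

record Graph (n : ℕ) : Set where
  field
    adj    : Fin n → Fin n → Bool
    sym    : ∀ u v → adj u v ≡ adj v u
    irrefl : ∀ v → adj v v ≡ false

module _ {n : ℕ} (G : Graph n) where
  open Graph G

  Edge : Fin n → Fin n → Set
  Edge u v = adj u v ≡ true

  NotComplete : Set
  NotComplete = ∃ λ u → ∃ λ v → u ≢ v × ¬ Edge u v

  data WalkIn (T : Subset n) : Fin n → Fin n → Set where
    here : ∀ {u} → u ∈ T → WalkIn T u u
    step : ∀ {u v w} → u ∈ T → Edge u v → WalkIn T v w → WalkIn T u w

  ConnectedOn : Subset n → Set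
  ConnectedOn T = ∀ u v → u ∈ T → v ∈ T → WalkIn T u v

  open import Data.Fin.Subset using (∁)

  SurvivesRemoval : Subset n → Set
  SurvivesRemoval S = (2 ≤ ∣ ∁ S ∣) × ConnectedOn (∁ S)

  ConnectivityAtLeast : ℕ → Set
  ConnectivityAtLeast k = ∀ (S : Subset n) → suc ∣ S ∣ ≤ k → SurvivesRemoval S

  CycNeighbours : (m : ℕ) → Fin (4 + m) → Fin (4 + m) → Set
  CycNeighbours m p q =
    (toℕ q ≡ (suc (toℕ p)) % (4 + m)) ⊎ (toℕ p ≡ (suc (toℕ q)) % (4 + m))

  -- G[U] is a cycle (through all of U, |U| = 4 + m ≥ 4) with exactly one chord.
  -- The cycle is listed by an injective map c, U = image of c.
  OneChordCycle : (m : ℕ) → (Fin (4 + m) → Fin n) → Set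
  OneChordCycle m c =
    Injective _≡_ _≡_ c
    × (∀ p q → CycNeighbours m p q → Edge (c p) (c q))
    × ∃ λ i → ∃ λ j →
        i ≢ j × ¬ CycNeighbours m i j × Edge (c i) (c j)
        × (∀ p q → Edge (c p) (c q) →
             CycNeighbours m p q ⊎ ((p ≡ i × q ≡ j) ⊎ (p ≡ j × q ≡ i)))

  OneChordFree : Set
  OneChordFree = ∀ m (c : Fin (4 + m) → Fin n) → ¬ OneChordCycle m c

  TriangleFree : Set
  TriangleFree = ∀ a b c → Edge a b → Edge b c → Edge a c → ⊥

-- Let x₀ y₀ c₀ be a triangle and K the set of x₀, y₀ and their common neighbours.
-- One-chord-freeness forbids a 4-cycle with exactly one diagonal; this makes K a clique
-- and leaves every vertex outside K with at most one neighbour in K. As G is not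
-- complete, some edge x w leaves K. Since G − x is connected, there is a shortest walk
-- in G − x from a neighbour of x outside K to K. Closed up by x and a third vertex z of K,
-- it becomes a cycle of length at least 4 whose only chord joins x to the walk's end.
module Submission where

open import Defs
open import Data.Nat
  using (ℕ; zero; suc; _+_; _∸_; _≤_; _<_; _%_; z≤n; s≤s; s≤s⁻¹; _≤?_; _<?_)
open import Data.Nat.Properties
open import Data.Nat.DivMod using (m<n⇒m%n≡m; n%n≡0; m%n≤m)
open import Data.Nat.Induction using (<-rec)
open import Data.Fin using (Fin; toℕ; fromℕ<) renaming (zero to fzero; _≟_ to _≟ᶠ_)
open import Data.Fin.Properties using (toℕ-injective; toℕ<n; toℕ-fromℕ<)
open import Data.Fin.Subset using (_∈_; ∁; ⁅_⁆; ∣_∣) renaming (⊥ to ∅)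
open import Data.Fin.Subset.Properties
  using (∉⊥; ∣⊥∣≡0; ∣⁅x⁆∣≡1; x∉p⇒x∈∁p; x∈∁p⇒x∉p; x≢y⇒x∉⁅y⁆; x∉⁅y⁆⇒x≢y)
open import Data.Bool using (true) renaming (_≟_ to _≟ᵇ_)
open import Data.Product using (∃; _×_; _,_; proj₁; proj₂)
open import Data.Sum using (_⊎_; inj₁; inj₂; swap)
open import Data.Empty using (⊥; ⊥-elim)
open import Relation.Nullary using (¬_; Dec; yes; no; contradiction)
open import Relation.Nullary.Decidable using (_⊎-dec_; _×-dec_)
open import Relation.Unary using (Decidable)
open import Relation.Binary using (tri<; tri≈; tri>)
open import Relation.Binary.PropositionalEquality 
  using (_≡_; _≢_; refl; sym; trans; cong; subst; subst₂; ≢-sym)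

module Sequences {A : Set} where

  _◂_ : A → (ℕ → A) → ℕ → A
  (a ◂ f) zero    = a
  (a ◂ f) (suc t) = f t

  graft : ℕ → (ℕ → A) → (ℕ → A) → ℕ → A
  graft i p r t with t ≤? i
  ... | yes _ = p t
  ... | no  _ = r t

  graft-≤ : ∀ {i p r t} → t ≤ i → graft i p r t ≡ p t
  graft-≤ {i} {t = t} t≤i with t ≤? i
  ... | yes _   = refl
  ... | no  t≰i = contradiction t≤i t≰i

  graft-> : ∀ {i p r t} → i < t → graft i p r t ≡ r t
  graft-> {i} {t = t} i<t with t ≤? i
  ... | yes t≤i = contradiction t≤i (<⇒≱ i<t)
  ... | no  _   = refl

open Sequences

module WalkTheory {n : ℕ} (G : Graph n) where
  open Graph G using (adj; irrefl) renaming (sym to adj-sym)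

  E : Fin n → Fin n → Set
  E = Edge G

  E-sym : ∀ {u v} → E u v → E v u
  E-sym {u} {v} uv = trans (adj-sym v u) uv

  E-irrefl : ∀ {u v} → E u v → u ≢ v
  E-irrefl {u} uv refl = contradiction (trans (sym uv) (irrefl u)) λ ()

  E? : ∀ u v → Dec (E u v)
  E? u v = adj u v ≟ᵇ true

  record IsWalk (P : Fin n → Set) (k : ℕ) (p : ℕ → Fin n) : Set where
    field
      inside : ∀ t → t ≤ k → P (p t)
      steps  : ∀ t → t < k → E (p t) (p (suc t))

  walkIn⇒isWalk : ∀ {T u v} → WalkIn G T u v →
                  ∃ λ k → ∃ λ p → p 0 ≡ u × p k ≡ v × IsWalk (_∈ T) k p
  walkIn⇒isWalk (here {u} u∈T) = 0 , (λ _ → u) , refl , refl , record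
    { inside = λ _ _ → u∈T ; steps = λ _ () }
  walkIn⇒isWalk {T} (step {u} u∈T uv rest) with walkIn⇒isWalk rest
  ... | k , p , p0 , pk , walk = suc k , u ◂ p , refl , pk , record
    { inside = inside′ ; steps = steps′ }
    where
    open IsWalk walk
    inside′ : ∀ t → t ≤ suc k → (u ◂ p) t ∈ T
    inside′ zero    _   = u∈T
    inside′ (suc t) t≤k = inside t (s≤s⁻¹ t≤k)
    steps′ : ∀ t → t < suc k → E ((u ◂ p) t) ((u ◂ p) (suc t))
    steps′ zero    _   = subst (E u) (sym p0) uv
    steps′ (suc t) t<k = steps t (s≤s⁻¹ t<k)

  walkIn-crossing : ∀ {P : Fin n → Set} {T a b} →
                    Decidable P → WalkIn G T a b → P a → ¬ P b →
                    ∃ λ u → ∃ λ v → P u × ¬ P v × E u v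
  walkIn-crossing P? (here _) Pa ¬Pb = contradiction Pa ¬Pb
  walkIn-crossing P? (step {u} {v} _ uv rest) Pu ¬Pb with P? v
  ... | yes Pv = walkIn-crossing P? rest Pv ¬Pb
  ... | no ¬Pv = u , v , Pu , ¬Pv , uv

  isWalk-map : ∀ {P Q k p} → (∀ {v} → P v → Q v) → IsWalk P k p → IsWalk Q k p
  isWalk-map P⇒Q walk = record { inside = λ t t≤k → P⇒Q (inside t t≤k) ; steps = steps }
    where open IsWalk walk

  module _ {P : Fin n → Set} {k : ℕ} {p : ℕ → Fin n} (walk : IsWalk P k p) where
    open IsWalk walk

    isWalk-prefix : ∀ {j} → j ≤ k → IsWalk P j p
    isWalk-prefix j≤k = record
      { inside = λ t t≤j → inside t (≤-trans t≤j j≤k)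
      ; steps  = λ t t<j → steps t (<-≤-trans t<j j≤k) }

    isWalk-suffix : ∀ {i} → i ≤ k → IsWalk P (k ∸ i) (λ t → p (t + i))
    isWalk-suffix {i} i≤k = record
      { inside = λ t t≤ → inside (t + i) (m≤o∸n⇒m+n≤o t i≤k t≤)
      ; steps  = λ t t< → steps (t + i) (m≤o∸n⇒m+n≤o (suc t) i≤k t<) }

    isWalk-graft : ∀ {i L r} → i ≤ k → E (p i) (r (suc i)) →
                   (∀ t → i < t → t ≤ L → P (r t)) →
                   (∀ t → i < t → t < L → E (r t) (r (suc t))) →
                   IsWalk P L (graft i p r)
    isWalk-graft {i} {L} {r} i≤k joint r-inside r-steps =
      record { inside = inside′ ; steps = steps′ }
      where
      inside′ : ∀ t → t ≤ L → P (graft i p r t)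
      inside′ t t≤L with t ≤? i
      ... | yes t≤i = inside t (≤-trans t≤i i≤k)
      ... | no  t≰i = r-inside t (≰⇒> t≰i) t≤L
      steps′ : ∀ t → t < L → E (graft i p r t) (graft i p r (suc t))
      steps′ t t<L with t ≤? i | suc t ≤? i
      ... | yes _   | yes t<i = steps t (<-≤-trans t<i i≤k)
      ... | yes t≤i | no  t≮i rewrite ≤-antisym t≤i (≮⇒≥ t≮i) = joint
      ... | no  t≰i | yes t<i = contradiction (<⇒≤ t<i) t≰i
      ... | no  t≰i | no  _   = r-steps t (≰⇒> t≰i) t<L

  connected : ∀ {k} → 1 ≤ k → ConnectivityAtLeast G k → ∀ u v → WalkIn G (∁ ∅) u v
  connected {k} 1≤k conn u v =
    proj₂ (conn ∅ ∣∅∣<k) u v (x∉p⇒x∈∁p ∉⊥) (x∉p⇒x∈∁p ∉⊥)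
    where
    ∣∅∣<k : suc ∣ ∅ {n} ∣ ≤ k
    ∣∅∣<k = subst (λ c → suc c ≤ k) (sym (∣⊥∣≡0 n)) 1≤k

  connected-minus : ∀ {k} → 2 ≤ k → ConnectivityAtLeast G k →
                    ∀ x u v → u ≢ x → v ≢ x → WalkIn G (∁ ⁅ x ⁆) u v
  connected-minus {k} 2≤k conn x u v u≢x v≢x =
    proj₂ (conn ⁅ x ⁆ ∣x∣<k) u v (x∉p⇒x∈∁p (x≢y⇒x∉⁅y⁆ u≢x))
                                 (x∉p⇒x∈∁p (x≢y⇒x∉⁅y⁆ v≢x))
    where
    ∣x∣<k : suc ∣ ⁅ x ⁆ ∣ ≤ k
    ∣x∣<k = subst (λ c → suc c ≤ k) (sym (∣⁅x⁆∣≡1 x)) 2≤k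

  ∈∁⁅⁆⇒≢ : ∀ {x v : Fin n} → v ∈ ∁ ⁅ x ⁆ → v ≢ x
  ∈∁⁅⁆⇒≢ v∈ = x∉⁅y⁆⇒x≢y (x∈∁p⇒x∉p v∈)

  -- The cycle f 0, …, f (3 + m) with the single chord f 0 f j, positions taken in ℕ.
  record OneChordSeq (m : ℕ) (f : ℕ → Fin n) (j : ℕ) : Set where
    field
      2≤j      : 2 ≤ j
      j≤2+m    : j ≤ 2 + m
      distinct : ∀ s t → s < t → t < 4 + m → f s ≢ f t
      steps    : ∀ t → t < 3 + m → E (f t) (f (suc t))
      closing  : E (f (3 + m)) (f 0)
      chord    : E (f 0) (f j)
      no-other : ∀ s t → s < t → t < 4 + m → E (f s) (f t) →
                 t ≡ suc s ⊎ (s ≡ 0 × (t ≡ 3 + m ⊎ t ≡ j))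

  module OneChordSeqCycle {m : ℕ} {f : ℕ → Fin n} {j : ℕ} (cyc : OneChordSeq m f j) where
    open OneChordSeq cyc

    N : ℕ
    N = 4 + m

    injective : ∀ {p q : Fin N} → f (toℕ p) ≡ f (toℕ q) → p ≡ q
    injective {p} {q} eq with <-cmp (toℕ p) (toℕ q)
    ... | tri< p<q _ _ = contradiction eq (distinct _ _ p<q (toℕ<n q))
    ... | tri≈ _ p≡q _ = toℕ-injective p≡q
    ... | tri> _ _ q<p = contradiction (sym eq) (distinct _ _ q<p (toℕ<n p))

    successor-edge : ∀ a b → a < N → b ≡ suc a % N → E (f a) (f b)
    successor-edge a b a<N b≡ with suc a <? N
    ... | yes 1+a<N = subst (λ c → E (f a) (f c)) (sym (trans b≡ (m<n⇒m%n≡m 1+a<N)))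
                            (steps a (s≤s⁻¹ 1+a<N))
    ... | no  1+a≮N = subst₂ (λ c d → E (f c) (f d)) (sym a≡) (sym b≡0) closing
      where
      a≡ : a ≡ 3 + m
      a≡ = suc-injective (≤-antisym a<N (≮⇒≥ 1+a≮N))
      b≡0 : b ≡ 0
      b≡0 = trans b≡ (trans (cong (λ c → suc c % N) a≡) (n%n≡0 N))

    cycle-edges : ∀ p q → CycNeighbours G m p q → E (f (toℕ p)) (f (toℕ q))
    cycle-edges p q (inj₁ eq) = successor-edge (toℕ p) (toℕ q) (toℕ<n p) eq
    cycle-edges p q (inj₂ eq) = E-sym (successor-edge (toℕ q) (toℕ p) (toℕ<n q) eq)

    j<N : j < N
    j<N = ≤-trans (s≤s j≤2+m) (n≤1+n _)
    J : Fin N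
    J = fromℕ< j<N
    toℕJ : toℕ J ≡ j
    toℕJ = toℕ-fromℕ< j<N

    0≢J : fzero ≢ J
    0≢J eq = <⇒≱ (subst (2 ≤_) (sym (trans (cong toℕ eq) toℕJ)) 2≤j) z≤n

    ¬0~J : ¬ CycNeighbours G m fzero J
    ¬0~J (inj₁ eq) = <⇒≱ 2≤j (subst (_≤ 1) (sym (trans (sym toℕJ) eq)) (m%n≤m 1 N))
    ¬0~J (inj₂ eq)
      with trans eq (trans (cong (λ c → suc c % N) toℕJ) (m<n⇒m%n≡m (s≤s (s≤s j≤2+m))))
    ... | ()

    chord′ : E (f 0) (f (toℕ J))
    chord′ = subst (λ c → E (f 0) (f c)) (sym toℕJ) chord

    Chord : Fin N → Fin N → Set
    Chord p q = (p ≡ fzero × q ≡ J) ⊎ (p ≡ J × q ≡ fzero)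

    only-ordered : ∀ p q → toℕ p < toℕ q → E (f (toℕ p)) (f (toℕ q)) →
                   CycNeighbours G m p q ⊎ Chord p q
    only-ordered p q p<q e with no-other (toℕ p) (toℕ q) p<q (toℕ<n q) e
    ... | inj₁ q≡1+p =
      inj₁ (inj₁ (trans q≡1+p (sym (m<n⇒m%n≡m (subst (_< N) q≡1+p (toℕ<n q))))))
    ... | inj₂ (p≡0 , inj₁ q≡3+m) =
      inj₁ (inj₂ (trans p≡0 (sym (trans (cong (λ c → suc c % N) q≡3+m) (n%n≡0 N)))))
    ... | inj₂ (p≡0 , inj₂ q≡j) =
      inj₂ (inj₁ (toℕ-injective p≡0 , toℕ-injective (trans q≡j (sym toℕJ))))

    only : ∀ p q → E (f (toℕ p)) (f (toℕ q)) → CycNeighbours G m p q ⊎ Chord p q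
    only p q e with <-cmp (toℕ p) (toℕ q)
    ... | tri< p<q _ _ = only-ordered p q p<q e
    ... | tri≈ _ p≡q _ = contradiction (cong f p≡q) (E-irrefl e)
    ... | tri> _ _ q<p with only-ordered q p q<p (E-sym e)
    ...   | inj₁ q~p               = inj₁ (swap q~p)
    ...   | inj₂ (inj₁ (q≡0 , p≡J)) = inj₂ (inj₂ (p≡J , q≡0))
    ...   | inj₂ (inj₂ (q≡J , p≡0)) = inj₂ (inj₁ (p≡0 , q≡J))

  oneChordSeq⇒oneChordCycle : ∀ {m f j} → OneChordSeq m f j →
                              OneChordCycle G m (λ p → f (toℕ p))
  oneChordSeq⇒oneChordCycle cyc = injective , cycle-edges , fzero , J , 0≢J , ¬0~J , chord′ , only
    where open OneChordSeqCycle cyc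

module ShortestWalks {n : ℕ} (G : Graph n) (Start End Allowed : Fin n → Set) where
  open WalkTheory G

  record Walk (k : ℕ) (p : ℕ → Fin n) : Set where
    field
      start  : Start (p 0)
      end    : End (p k)
      isWalk : IsWalk Allowed k p

  Shortest : ℕ → Set
  Shortest k = ∀ L q → L < k → ¬ Walk L q

  -- Shortest k is a negative statement, so rather than constructing a shortest walk
  -- we refute every walk by strong induction on its length.
  no-walk : (∀ k p → Walk k p → Shortest k → ⊥) → ∀ k p → Walk k p → ⊥
  no-walk absurd = <-rec (λ k → ∀ p → Walk k p → ⊥)
                         (λ k ih p W → absurd k p W (λ L q L<k → ih L<k q))

  module Properties {k : ℕ} {p : ℕ → Fin n} (W : Walk k p) (shortest : Shortest k) where
    open Walk W
    open IsWalk isWalk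

    no-end-before : ∀ {i} → i < k → ¬ End (p i)
    no-end-before i<k end-i = shortest _ p i<k record
      { start = start ; end = end-i ; isWalk = isWalk-prefix isWalk (<⇒≤ i<k) }

    no-start-after : ∀ {i} → 0 < i → i ≤ k → ¬ Start (p i)
    no-start-after {i} 0<i i≤k start-i = shortest _ (λ t → p (t + i)) (∸-monoʳ-< 0<i i≤k) record
      { start  = start-i
      ; end    = subst (λ t → End (p t)) (sym (m∸n+n≡m i≤k)) end
      ; isWalk = isWalk-suffix isWalk i≤k }

    no-chord : ∀ {i j} → suc i < j → j ≤ k → ¬ E (p i) (p j)
    no-chord {i} {j} 1+i<j j≤k e = shortest (k ∸ d) q (∸-monoʳ-< 0<d d≤k) record
      { start  = subst Start (sym (graft-≤ {i = i} {p = p} {r = λ t → p (t + d)} z≤n)) start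
      ; end    = subst End (sym (trans (graft-> i<k∸d) (cong p (m∸n+n≡m d≤k)))) end
      ; isWalk = isWalk-graft isWalk (<⇒≤ (<-trans (n<1+n i) (<-≤-trans 1+i<j j≤k)))
                   (subst (λ t → E (p i) (p t)) (sym 1+i+d≡j) e)
                   (λ t _ t≤ → inside (t + d) (m≤o∸n⇒m+n≤o t d≤k t≤))
                   (λ t _ t< → steps (t + d) (m≤o∸n⇒m+n≤o (suc t) d≤k t<)) }
      where
      d = j ∸ suc i
      q = graft i p (λ t → p (t + d))
      1+i+d≡j : suc i + d ≡ j
      1+i+d≡j = m+[n∸m]≡n (<⇒≤ 1+i<j)
      0<d : 0 < d
      0<d = m<n⇒0<n∸m 1+i<j
      d≤k : d ≤ k
      d≤k = ≤-trans (m∸n≤m j (suc i)) j≤k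
      i<k∸d : i < k ∸ d
      i<k∸d = m+n≤o⇒m≤o∸n (suc i) (subst (_≤ k) (sym 1+i+d≡j) j≤k)

    no-edge-to-end : ∀ {i a} → suc i < k → End a → Allowed a → ¬ E (p i) a
    no-edge-to-end {i} {a} 1+i<k end-a allowed-a e = shortest (suc i) q 1+i<k record
      { start  = subst Start (sym (graft-≤ {i = i} {p = p} {r = λ _ → a} z≤n)) start
      ; end    = subst End (sym (graft-> (n<1+n i))) end-a
      ; isWalk = isWalk-graft isWalk (<⇒≤ (<-trans (n<1+n i) 1+i<k)) e
                   (λ _ _ _ → allowed-a)
                   (λ t i<t t<1+i → contradiction (s≤s⁻¹ t<1+i) (<⇒≱ i<t)) }
      where
      q = graft i p (λ _ → a)

    distinct : ∀ {s t} → s < t → t ≤ k → p s ≢ p t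
    distinct {s} {t} s<t t≤k ps≡pt with m≤n⇒m<n∨m≡n t≤k
    ... | inj₁ t<k  =
      no-chord (s≤s s<t) t<k (subst (λ v → E v (p (suc t))) (sym ps≡pt) (steps t t<k))
    ... | inj₂ refl = no-end-before s<t (subst End (sym ps≡pt) end)

module OneChordFreeGraph {n : ℕ} (G : Graph n) (ocf : OneChordFree G) where
  open WalkTheory G

  diamond : ∀ {a b c d} → E a b → E b c → E c d → E d a → E a c → b ≢ d → E b d
  diamond {a} {b} {c} {d} ab bc cd da ac b≢d with E? b d
  ... | yes bd = bd
  ... | no ¬bd = ⊥-elim (ocf 0 _ (oneChordSeq⇒oneChordCycle record
    { 2≤j = ≤-refl ; j≤2+m = ≤-refl ; distinct = distinct ; steps = steps
    ; closing = da ; chord = ac ; no-other = no-other }))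
    where
    f : ℕ → Fin n
    f 0 = a
    f 1 = b
    f 2 = c
    f _ = d
    distinct : ∀ s t → s < t → t < 4 → f s ≢ f t
    distinct _ _ (s≤s z≤n)       (s≤s (s≤s z≤n))                = E-irrefl ab
    distinct _ _ (s≤s z≤n)       (s≤s (s≤s (s≤s z≤n)))          = E-irrefl ac
    distinct _ _ (s≤s (s≤s z≤n)) (s≤s (s≤s (s≤s z≤n)))          = E-irrefl bc
    distinct _ _ (s≤s z≤n)       (s≤s (s≤s (s≤s (s≤s z≤n))))    = ≢-sym (E-irrefl da)
    distinct _ _ (s≤s (s≤s z≤n)) (s≤s (s≤s (s≤s (s≤s z≤n))))    = b≢d
    distinct _ _ (s≤s (s≤s (s≤s z≤n))) (s≤s (s≤s (s≤s (s≤s z≤n)))) = E-irrefl cd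
    steps : ∀ t → t < 3 → E (f t) (f (suc t))
    steps _ (s≤s z≤n)             = ab
    steps _ (s≤s (s≤s z≤n))       = bc
    steps _ (s≤s (s≤s (s≤s z≤n))) = cd
    no-other : ∀ s t → s < t → t < 4 → E (f s) (f t) →
               t ≡ suc s ⊎ (s ≡ 0 × (t ≡ 3 ⊎ t ≡ 2))
    no-other _ _ (s≤s z≤n)       (s≤s (s≤s z≤n))                _ = inj₁ refl
    no-other _ _ (s≤s z≤n)       (s≤s (s≤s (s≤s z≤n)))          _ = inj₂ (refl , inj₂ refl)
    no-other _ _ (s≤s (s≤s z≤n)) (s≤s (s≤s (s≤s z≤n)))          _ = inj₁ refl
    no-other _ _ (s≤s z≤n)       (s≤s (s≤s (s≤s (s≤s z≤n))))    _ = inj₂ (refl , inj₁ refl)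
    no-other _ _ (s≤s (s≤s z≤n)) (s≤s (s≤s (s≤s (s≤s z≤n))))    e = contradiction e ¬bd
    no-other _ _ (s≤s (s≤s (s≤s z≤n))) (s≤s (s≤s (s≤s (s≤s z≤n)))) _ = inj₁ refl

  module TriangleHull {x₀ y₀ c₀ : Fin n}
                      (x₀y₀ : E x₀ y₀) (y₀c₀ : E y₀ c₀) (x₀c₀ : E x₀ c₀) where

    K : Fin n → Set
    K v = v ≡ x₀ ⊎ v ≡ y₀ ⊎ (E x₀ v × E y₀ v)

    K? : Decidable K
    K? v = (v ≟ᶠ x₀) ⊎-dec (v ≟ᶠ y₀) ⊎-dec (E? x₀ v ×-dec E? y₀ v)

    x₀∈K : K x₀
    x₀∈K = inj₁ refl

    y₀∈K : K y₀
    y₀∈K = inj₂ (inj₁ refl)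

    ∉K⇒≢∈K : ∀ {u v} → ¬ K u → K v → u ≢ v
    ∉K⇒≢∈K u∉K v∈K refl = u∉K v∈K

    K-clique : ∀ {u v} → K u → K v → u ≢ v → E u v
    K-clique (inj₁ refl)               (inj₁ refl)                 u≢v = contradiction refl u≢v
    K-clique (inj₁ refl)               (inj₂ (inj₁ refl))          _   = x₀y₀
    K-clique (inj₁ refl)               (inj₂ (inj₂ (x₀v , _)))     _   = x₀v
    K-clique (inj₂ (inj₁ refl))        (inj₁ refl)                 _   = E-sym x₀y₀
    K-clique (inj₂ (inj₁ refl))        (inj₂ (inj₁ refl))          u≢v = contradiction refl u≢v
    K-clique (inj₂ (inj₁ refl))        (inj₂ (inj₂ (_ , y₀v)))     _   = y₀v
    K-clique (inj₂ (inj₂ (x₀u , _)))   (inj₁ refl)                 _   = E-sym x₀u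
    K-clique (inj₂ (inj₂ (_ , y₀u)))   (inj₂ (inj₁ refl))          _   = E-sym y₀u
    K-clique (inj₂ (inj₂ (x₀u , y₀u))) (inj₂ (inj₂ (x₀v , y₀v)))   u≢v =
      diamond x₀u (E-sym y₀u) y₀v (E-sym x₀v) x₀y₀ u≢v

    K-neighbour-unique : ∀ {v a b} → ¬ K v → K a → K b → E v a → E v b → a ≡ b
    K-neighbour-unique {v} {a} {b} v∉K a∈K b∈K va vb with a ≟ᶠ b
    ... | yes a≡b = a≡b
    ... | no  a≢b = ⊥-elim (v∉K (inj₂ (inj₂ (E-sym (adjacent x₀∈K) , E-sym (adjacent y₀∈K)))))
      where
      adjacent : ∀ {c} → K c → E v c
      adjacent {c} c∈K with c ≟ᶠ a | c ≟ᶠ b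
      ... | yes refl | _        = va
      ... | no  _    | yes refl = vb
      ... | no  c≢a  | no  c≢b  =
        diamond (E-sym va) vb (K-clique b∈K c∈K (≢-sym c≢b)) (K-clique c∈K a∈K c≢a)
                (K-clique a∈K b∈K a≢b) (∉K⇒≢∈K v∉K c∈K)

    K-avoiding-x₀ : ∀ v → ∃ λ z → K z × z ≢ x₀ × z ≢ v
    K-avoiding-x₀ v with y₀ ≟ᶠ v
    ... | no  y₀≢v = y₀ , y₀∈K , ≢-sym (E-irrefl x₀y₀) , y₀≢v
    ... | yes refl = c₀ , inj₂ (inj₂ (x₀c₀ , y₀c₀)) , ≢-sym (E-irrefl x₀c₀) , ≢-sym (E-irrefl y₀c₀)

    K-avoiding : ∀ u v → ∃ λ z → K z × z ≢ u × z ≢ v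
    K-avoiding u v with x₀ ≟ᶠ u | x₀ ≟ᶠ v
    ... | yes refl | _        = K-avoiding-x₀ v
    ... | no  _    | yes refl with K-avoiding-x₀ u
    ...   | z , z∈K , z≢v , z≢u = z , z∈K , z≢u , z≢v
    K-avoiding u v | no x₀≢u | no x₀≢v = x₀ , x₀∈K , x₀≢u , x₀≢v

    outside-K : NotComplete G → ∃ λ o → ¬ K o
    outside-K (u , v , u≢v , ¬uv) with K? u | K? v
    ... | yes u∈K | yes v∈K = contradiction (K-clique u∈K v∈K u≢v) ¬uv
    ... | yes _   | no  v∉K = v , v∉K
    ... | no  u∉K | _       = u , u∉K

    module _ {x : Fin n} (x∈K : K x) where
      open ShortestWalks G (λ v → E x v × ¬ K v) K (_≢ x)

      -- The cycle x, p 0, …, p k, z, whose only chord is x p k.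
      module ChordedCycle (m : ℕ) (p : ℕ → Fin n)
                          (W : Walk (suc m) p) (shortest : Shortest (suc m))
                          {z : Fin n} (z∈K : K z) (z≢x : z ≢ x) (z≢pk : z ≢ p (suc m)) where
        open Walk W
        open IsWalk isWalk
        open Properties W shortest

        k : ℕ
        k = suc m

        g : ℕ → Fin n
        g = graft k p (λ _ → z)

        g-≤ : ∀ {t} → t ≤ k → g t ≡ p t
        g-≤ = graft-≤ {i = k} {p = p} {r = λ _ → z}

        g-> : ∀ {t} → k < t → g t ≡ z
        g-> = graft-> {i = k} {p = p} {r = λ _ → z}

        g-view : ∀ {t} → t ≤ suc k → (t ≤ k × g t ≡ p t) ⊎ (t ≡ suc k × g t ≡ z)
        g-view t≤1+k with m≤n⇒m<n∨m≡n t≤1+k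
        ... | inj₁ t<1+k = inj₁ (s≤s⁻¹ t<1+k , g-≤ (s≤s⁻¹ t<1+k))
        ... | inj₂ refl  = inj₂ (refl , g-> ≤-refl)

        z-off-walk : ∀ {s} → s ≤ k → p s ≢ z
        z-off-walk s≤k ps≡z with m≤n⇒m<n∨m≡n s≤k
        ... | inj₁ s<k  = no-end-before s<k (subst K (sym ps≡z) z∈K)
        ... | inj₂ refl = z≢pk (sym ps≡z)

        f : ℕ → Fin n
        f = x ◂ g

        f-distinct : ∀ s t → s < t → t < 4 + m → f s ≢ f t
        f-distinct zero (suc t) _ t< x≡gt with g-view (s≤s⁻¹ (s≤s⁻¹ t<))
        ... | inj₁ (t≤k , gt≡pt) = inside t t≤k (sym (trans x≡gt gt≡pt))
        ... | inj₂ (_ , gt≡z)    = z≢x (sym (trans x≡gt gt≡z))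
        f-distinct (suc s) (suc t) s<t t< gs≡gt with g-view (s≤s⁻¹ (s≤s⁻¹ t<))
        ... | inj₁ (t≤k , gt≡pt) =
          distinct (s≤s⁻¹ s<t) t≤k (trans (sym (g-≤ s≤k)) (trans gs≡gt gt≡pt))
          where s≤k = ≤-trans (<⇒≤ (s≤s⁻¹ s<t)) t≤k
        ... | inj₂ (refl , gt≡z) =
          z-off-walk s≤k (trans (sym (g-≤ s≤k)) (trans gs≡gt gt≡z))
          where s≤k = s≤s⁻¹ (s≤s⁻¹ s<t)

        f-steps : ∀ t → t < 3 + m → E (f t) (f (suc t))
        f-steps zero    _  = subst (E x) (sym (g-≤ z≤n)) (proj₁ start)
        f-steps (suc t) t< with m≤n⇒m<n∨m≡n (s≤s⁻¹ (s≤s⁻¹ t<))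
        ... | inj₁ t<k  = subst₂ E (sym (g-≤ (<⇒≤ t<k))) (sym (g-≤ t<k)) (steps t t<k)
        ... | inj₂ refl = subst₂ E (sym (g-≤ ≤-refl)) (sym (g-> ≤-refl))
                                 (K-clique end z∈K (≢-sym z≢pk))

        f-no-other : ∀ s t → s < t → t < 4 + m → E (f s) (f t) →
                     t ≡ suc s ⊎ (s ≡ 0 × (t ≡ 3 + m ⊎ t ≡ suc k))
        f-no-other zero (suc t) _ t< e with g-view (s≤s⁻¹ (s≤s⁻¹ t<))
        ... | inj₂ (refl , _) = inj₂ (refl , inj₁ refl)
        ... | inj₁ (t≤k , gt≡pt) with m≤n⇒m<n∨m≡n t≤k
        ...   | inj₂ refl = inj₂ (refl , inj₂ refl)
        ...   | inj₁ t<k with t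
        ...     | zero   = inj₁ refl
        ...     | suc _  = ⊥-elim (no-start-after (s≤s z≤n) (<⇒≤ t<k)
                                      (subst (E x) gt≡pt e , no-end-before t<k))
        f-no-other (suc s) (suc t) s<t t< e with g-view (s≤s⁻¹ (s≤s⁻¹ t<))
        ... | inj₁ (t≤k , gt≡pt) with m≤n⇒m<n∨m≡n (s≤s⁻¹ s<t)
        ...   | inj₂ 1+s≡t  = inj₁ (cong suc (sym 1+s≡t))
        ...   | inj₁ 1+s<t  = ⊥-elim (no-chord 1+s<t t≤k (subst₂ E (g-≤ s≤k) gt≡pt e))
          where s≤k = ≤-trans (<⇒≤ (s≤s⁻¹ s<t)) t≤k
        f-no-other (suc s) (suc t) s<t t< e | inj₂ (refl , gt≡z)
          with m≤n⇒m<n∨m≡n (s≤s⁻¹ (s≤s⁻¹ s<t))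
        ... | inj₂ refl = inj₁ refl
        ... | inj₁ s<k with m≤n⇒m<n∨m≡n s<k
        ...   | inj₁ 1+s<k  = ⊥-elim (no-edge-to-end 1+s<k z∈K z≢x ps-z)
          where ps-z = subst₂ E (g-≤ (<⇒≤ s<k)) gt≡z e
        ...   | inj₂ refl   = ⊥-elim (z≢pk (sym pk≡z))
          where pk≡z = K-neighbour-unique (no-end-before s<k) end z∈K (steps s s<k)
                                          (subst₂ E (g-≤ (<⇒≤ s<k)) gt≡z e)

        cycle : OneChordSeq m f (suc k)
        cycle = record
          { 2≤j = s≤s (s≤s z≤n) ; j≤2+m = ≤-refl ; distinct = f-distinct ; steps = f-steps
          ; closing  = subst (λ v → E v x) (sym (g-> ≤-refl)) (K-clique z∈K x∈K z≢x)
          ; chord    = subst (E x) (sym (g-≤ ≤-refl))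
                               (K-clique x∈K end (≢-sym (inside k ≤-refl)))
          ; no-other = f-no-other }

      no-shortest-walk : ∀ k p → Walk k p → Shortest k → ⊥
      no-shortest-walk zero p W _ = proj₂ (Walk.start W) (Walk.end W)
      no-shortest-walk (suc m) p W shortest with K-avoiding x (p (suc m))
      ... | z , z∈K , z≢x , z≢pk =
        ocf m _ (oneChordSeq⇒oneChordCycle (ChordedCycle.cycle m p W shortest z∈K z≢x z≢pk))

      no-walk-avoiding : ∀ {w a} → E x w → ¬ K w → K a → ¬ WalkIn G (∁ ⁅ x ⁆) w a
      no-walk-avoiding xw w∉K a∈K walk-wa with walkIn⇒isWalk walk-wa
      ... | L , p , p0≡w , pL≡a , walk = no-walk no-shortest-walk L p record
        { start  = subst (λ v → E x v × ¬ K v) (sym p0≡w) (xw , w∉K)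
        ; end    = subst K (sym pL≡a) a∈K
        ; isWalk = isWalk-map ∈∁⁅⁆⇒≢ walk }

lemma3 : ∀ {n : ℕ} (G : Graph n) → NotComplete G → ConnectivityAtLeast G 2 →
         OneChordFree G → TriangleFree G
lemma3 G nc conn ocf x₀ y₀ c₀ x₀y₀ y₀c₀ x₀c₀ =
  let open WalkTheory G
      open OneChordFreeGraph G ocf
      open TriangleHull x₀y₀ y₀c₀ x₀c₀
      o , o∉K = outside-K nc
      x , w , x∈K , w∉K , xw = walkIn-crossing K? (connected (s≤s z≤n) conn x₀ o) x₀∈K o∉K
      a , a∈K , a≢x , _ = K-avoiding x x
      w≢x = ∉K⇒≢∈K w∉K x∈K
  in no-walk-avoiding x∈K xw w∉K a∈K (connected-minus ≤-refl conn x w a w≢x a≢x)
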